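{- Let $k\ge 2$ be an integer and let $f_k(z)=\sum_{n\ge1}\gamma_k(n)q^n$ be as in the context. Then for any prime $p>3$ and integer $r \geq 1$, $$\gamma_k(p)^r = \sum_{t=0}^{\lfloor \frac{r-1}{2} \rfloor} \binom{r}{t} p^{t(k-1)} \gamma_{(r-2t)(k-1)+1}(p) + \begin{cases} \binom{r}{r/2} p^{\frac{r}{2}(k-1)}, & \text{if } p \equiv 1 \pmod 6 \text{ and } r \text{ even},\\ 0, & \text{otherwise}. \end{cases}$$ Also, for $k$ odd, $\gamma_k(3)^r = \gamma_{r(k-1)+1}(3)$.
   Context: For each integer $k\ge 2$, $f_k(z)=\sum_{n\ge1}\gamma_k(n)q^n$ is a weight $k$ newform with complex multiplication by $\mathbb{Q}(\sqrt{ -3})$, lying in $S_k(\Gamma_0(36))$ if $k\equiv 0,2 \pmod 6$, in $S_k(\Gamma_0(3),(\tfrac{ -3}{\cdot}))$ if $k\equiv 1\pmod 6$, in $S_k(\Gamma_0(12),(\tfrac{ -3}{\cdot}))$ if $k\equiv 3,5\pmod 6$, and in $S_k(\Gamma_0(9))$ if $k\equiv 4\pmod 6$, whose coefficients at odd primes $p$ are: $\gamma_k(p)=(a+b\sqrt{ -3})^{k-1}+(a-b\sqrt{ -3})^{k-1}$ if $p\equiv 1\pmod 6$, where $p=a^2+3b^2$ with integers $a\equiv 1\pmod 3$, $b>0$; $\gamma_k(3)=(-3)^{(k-1)/2}$ if $k$ is odd; and $\gamma_k(p)=0$ otherwise. -}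

module Defs where

open import Data.Nat as ℕ using (ℕ; zero; suc; _∸_; _%_; _/_)
open import Data.Integer as ℤ using (ℤ; +_; _+_; _*_; -_; _-_; _^_; 0ℤ)
open import Data.Integer.Divisibility using (_∣_)
open import Data.List using (List; map; foldr; upTo)
open import Data.Product using (_×_; _,_; proj₁)
open import Relation.Binary.PropositionalEquality using (_≡_)
open import Relation.Nullary using (yes; no)

-- Elements x + y√-3 of ℤ[√-3], as pairs (x , y).
ℤω : Set
ℤω = ℤ × ℤ

_⊗_ : ℤω → ℤω → ℤω
(x₁ , y₁) ⊗ (x₂ , y₂) = (x₁ * x₂ - + 3 * (y₁ * y₂)) , (x₁ * y₂ + x₂ * y₁)

_⊕_ : ℤω → ℤω → ℤω
(x₁ , y₁) ⊕ (x₂ , y₂) = (x₁ + x₂) , (y₁ + y₂)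

conj : ℤω → ℤω
conj (x , y) = x , - y

pow : ℤω → ℕ → ℤω
pow z zero    = (+ 1) , 0ℤ
pow z (suc n) = z ⊗ pow z n

IsRep : ℕ → ℤ → ℤ → Set
IsRep p a b = (+ p ≡ a * a + + 3 * (b * b)) × ((+ 3) ∣ (a - + 1)) × (+ 0 ℤ.< b)

-- γ_k(p) for a prime p > 3, given the representation p = a² + 3b² (used only if p ≡ 1 mod 6):
-- (a+b√-3)^{k-1} + (a-b√-3)^{k-1} (an integer, i.e. the rational part) if p ≡ 1 (mod 6), else 0.
gammaP : ℕ → ℕ → ℤ → ℤ → ℤ
gammaP k p a b with p % 6 ℕ.≟ 1
... | yes _ = proj₁ (pow (a , b) (k ∸ 1) ⊕ pow (conj (a , b)) (k ∸ 1))
... | no  _ = 0ℤ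

gamma3 : ℕ → ℤ
gamma3 k with k % 2 ℕ.≟ 1
... | yes _ = (- + 3) ^ ((k ∸ 1) / 2)
... | no  _ = 0ℤ

sumℤ : List ℤ → ℤ
sumℤ = foldr _+_ 0ℤ

if1mod6∧even : ℕ → ℕ → ℤ → ℤ
if1mod6∧even p r v with p % 6 ℕ.≟ 1 | r % 2 ℕ.≟ 0
... | yes _ | yes _ = v
... | _     | _     = 0ℤ

module Submission where

-- For p ≡ 1 (mod 6) write p = a² + 3b² and α = a + b√-3, so that αᾱ = p and
-- γ_n(p) = α^(n-1) + ᾱ^(n-1) is the trace of α^(n-1).  With x = α^(k-1) and
-- y = ᾱ^(k-1) we have γ_k(p) = x + y and xy = p^(k-1), so the identity is the
-- binomial theorem for (x + y)^r with the terms of degree t and r - t in x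
-- combined:  C(r,t) (xy)^t (x^(r-2t) + y^(r-2t)) = C(r,t) p^(t(k-1)) γ_{(r-2t)(k-1)+1}(p),
-- plus the central term C(r,r/2) (xy)^(r/2) when r is even.  For the other
-- primes p > 3 both sides vanish, and γ_k(3)^r = γ_{r(k-1)+1}(3) because both
-- are (-3)^(r(k-1)/2).

open import Algebra.Bundles using (CommutativeMonoid; CommutativeSemiring)

module PairingIndices where

  open import Data.Nat using (suc; _+_; _*_; _∸_; _≤_; _<_; s≤s⁻¹)
  open import Data.Nat.Properties using (+-assoc; +-identityʳ; m+[n∸m]≡n; m+n∸m≡n; +-mono-<; +-monoˡ-≤; m≤m+n; ≤-trans)
  open import Relation.Binary.PropositionalEquality using (_≡_; cong; sym; subst; module ≡-Reasoning)
  open ≡-Reasoning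

  ∸-half : ∀ {r t} → 2 * t ≤ r → r ∸ t ≡ t + (r ∸ 2 * t)
  ∸-half {r} {t} 2t≤r = begin
    r ∸ t                      ≡⟨ cong (_∸ t) (sym (m+[n∸m]≡n 2t≤r)) ⟩
    t + (t + 0) + d ∸ t        ≡⟨ cong (_∸ t) (+-assoc t (t + 0) d) ⟩
    t + (t + 0 + d) ∸ t        ≡⟨ m+n∸m≡n t _ ⟩
    t + 0 + d                  ≡⟨ cong (_+ d) (+-identityʳ t) ⟩
    t + d                      ∎
    where d = r ∸ 2 * t

  paired-index-bound : ∀ n k {r t} → suc r ≡ n + k + n → t < n → 2 * t ≤ r
  paired-index-bound n k {r} {t} e t<n = subst (_≤ r) (cong (t +_) (sym (+-identityʳ t))) (s≤s⁻¹ 2t<r+1)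
    where
    2t<r+1 : t + t < suc r
    2t<r+1 = subst (t + t <_) (sym e) (≤-trans (+-mono-< t<n t<n) (+-monoˡ-≤ n (m≤m+n n k)))

module InitialSums {c ℓ} (M : CommutativeMonoid c ℓ) where

  open import Data.Nat using (ℕ; zero; suc; _+_; _∸_; _<_; s≤s; z≤n)
  open import Data.Nat.Properties using (+-suc; +-identityʳ; +-∸-assoc; ≤-trans; m≤m+n)
  open import Function using (_∘_)
  import Relation.Binary.PropositionalEquality as ≡
  open ≡ using (_≡_)
  open CommutativeMonoid M renaming (_∙_ to _⊹_; ε to 0#)
  open import Relation.Binary.Reasoning.Setoid setoid

  Σ< : ℕ → (ℕ → Carrier) → Carrier
  Σ< zero    f = 0#
  Σ< (suc n) f = f 0 ⊹ Σ< n (f ∘ suc)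

  Σ<-cong : ∀ n {f g : ℕ → Carrier} → (∀ i → i < n → f i ≈ g i) → Σ< n f ≈ Σ< n g
  Σ<-cong zero    f≈g = refl
  Σ<-cong (suc n) f≈g = ∙-cong (f≈g 0 (s≤s z≤n)) (Σ<-cong n (λ i i<n → f≈g (suc i) (s≤s i<n)))

  Σ<-zero : ∀ n → Σ< n (λ _ → 0#) ≈ 0#
  Σ<-zero zero    = refl
  Σ<-zero (suc n) = trans (identityˡ _) (Σ<-zero n)

  Σ<-snoc : ∀ n f → Σ< (suc n) f ≈ Σ< n f ⊹ f n
  Σ<-snoc zero    f = trans (identityʳ (f 0)) (sym (identityˡ (f 0)))
  Σ<-snoc (suc n) f = begin
    f 0 ⊹ Σ< (suc n) (f ∘ suc)        ≈⟨ ∙-congˡ (Σ<-snoc n (f ∘ suc)) ⟩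
    f 0 ⊹ (Σ< n (f ∘ suc) ⊹ f (suc n)) ≈⟨ assoc _ _ _ ⟨
    Σ< (suc n) f ⊹ f (suc n)            ∎

  private
    move-last : ∀ a b c d → a ⊹ ((b ⊹ c) ⊹ d) ≈ ((a ⊹ d) ⊹ b) ⊹ c
    move-last a b c d = begin
      a ⊹ ((b ⊹ c) ⊹ d) ≈⟨ ∙-congˡ (comm _ d) ⟩
      a ⊹ (d ⊹ (b ⊹ c)) ≈⟨ assoc a d _ ⟨
      (a ⊹ d) ⊹ (b ⊹ c) ≈⟨ assoc _ b c ⟨
      ((a ⊹ d) ⊹ b) ⊹ c ∎

  Σ<-pair : ∀ n k f → Σ< (n + k + n) f
            ≈ Σ< n (λ t → f t ⊹ f (n + k + n ∸ suc t)) ⊹ Σ< k (λ i → f (n + i))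
  Σ<-pair zero k f = begin
    Σ< (k + 0) f   ≡⟨ ≡.cong (λ N → Σ< N f) (+-identityʳ k) ⟩
    Σ< k f         ≈⟨ identityˡ _ ⟨
    0# ⊹ Σ< k f    ∎
  Σ<-pair (suc n) k f = begin
    f 0 ⊹ Σ< (n + k + suc n) g          ≡⟨ ≡.cong (λ L → f 0 ⊹ Σ< L g) (+-suc (n + k) n) ⟩
    f 0 ⊹ Σ< (suc N) g                  ≈⟨ ∙-congˡ (Σ<-snoc N g) ⟩
    f 0 ⊹ (Σ< N g ⊹ g N)                ≈⟨ ∙-congˡ (∙-congʳ (Σ<-pair n k g)) ⟩
    f 0 ⊹ ((pairs ⊹ middle) ⊹ g N)      ≈⟨ move-last (f 0) pairs middle (g N) ⟩
    ((f 0 ⊹ g N) ⊹ pairs) ⊹ middle      ≈⟨ ∙-congʳ (∙-cong (∙-congˡ (reflexive (≡.cong f last≡))) (Σ<-cong n shift)) ⟩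
    Σ< (suc n) (λ t → f t ⊹ f (suc n + k + suc n ∸ suc t)) ⊹ middle ∎
    where
    N = n + k + n
    g = f ∘ suc
    pairs  = Σ< n (λ t → g t ⊹ g (N ∸ suc t))
    middle = Σ< k (λ i → g (n + i))
    last≡ : suc N ≡ n + k + suc n
    last≡ = ≡.sym (+-suc (n + k) n)
    shift : ∀ t → t < n → g t ⊹ g (N ∸ suc t) ≈ f (suc t) ⊹ f (n + k + suc n ∸ suc t)
    shift t t<n = ∙-congˡ (reflexive (≡.cong f (≡.trans (≡.sym (+-∸-assoc 1 t<N)) (≡.cong (_∸ suc t) last≡))))
      where t<N = ≤-trans t<n (≤-trans (m≤m+n n k) (m≤m+n (n + k) n))

module SymmetricBinomial {c ℓ} (R : CommutativeSemiring c ℓ) (x y : CommutativeSemiring.Carrier R) where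

  open import Data.Nat as ℕ using (ℕ; zero; suc; _∸_; _≤_; _<_)
  import Data.Nat.Properties as ℕₚ
  open ℕₚ using (+-suc; m≤m+n; m+n∸n≡m; m∸[m∸n]≡n; ≤-trans)
  open import Data.Nat.Combinatorics using (_C_; nCk≡nC[n∸k])
  open import Data.Fin using (toℕ)
  open import Function using (_∘_)
  import Relation.Binary.PropositionalEquality as ≡
  open ≡ using (_≡_)
  open CommutativeSemiring R
  open InitialSums +-commutativeMonoid using (Σ<; Σ<-cong; Σ<-pair)
  open PairingIndices using (∸-half; paired-index-bound)
  open import Algebra.Definitions.RawMonoid +-rawMonoid using (_×_; sum)
  open import Algebra.Properties.Monoid.Mult +-monoid using (×-congʳ; ×-cong)
  open import Algebra.Properties.CommutativeMonoid.Mult +-commutativeMonoid using (×-distrib-+)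
  open import Algebra.Properties.Semiring.Exp semiring using (_^_; ^-homo-*)
  open import Algebra.Properties.CommutativeSemiring.Exp R using (^-distrib-*)
  import Algebra.Properties.CommutativeSemiring.Binomial R as Binomial
  open import Relation.Binary.Reasoning.Setoid setoid

  binomialTerm : ℕ → ℕ → Carrier
  binomialTerm r j = (r C j) × (x ^ j * y ^ (r ∸ j))

  pairTerm : ℕ → ℕ → Carrier
  pairTerm r t = (r C t) × ((x * y) ^ t * (x ^ (r ∸ 2 ℕ.* t) + y ^ (r ∸ 2 ℕ.* t)))

  binomial-theorem : ∀ r → (x + y) ^ r ≈ Σ< (suc r) (binomialTerm r)
  binomial-theorem r = trans (Binomial.theorem r x y) (reflexive (sum-toℕ (suc r) (binomialTerm r)))
    where
    sum-toℕ : ∀ n f → sum {n} (f ∘ toℕ) ≡ Σ< n f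
    sum-toℕ zero    f = ≡.refl
    sum-toℕ (suc n) f = ≡.cong (f 0 +_) (sum-toℕ n (f ∘ suc))

  pair-binomialTerms : ∀ r t → 2 ℕ.* t ≤ r → binomialTerm r t + binomialTerm r (r ∸ t) ≈ pairTerm r t
  pair-binomialTerms r t 2t≤r = begin
    binomialTerm r t + binomialTerm r (r ∸ t)               ≈⟨ +-cong lower upper ⟩
    coeff × (u * (v * y ^ d)) + coeff × ((u * x ^ d) * v)   ≈⟨ ×-distrib-+ _ _ coeff ⟨
    coeff × (u * (v * y ^ d) + (u * x ^ d) * v)             ≈⟨ ×-congʳ coeff (factor (y ^ d) (x ^ d)) ⟩
    coeff × ((u * v) * (x ^ d + y ^ d))                     ≈⟨ ×-congʳ coeff (*-congʳ (^-distrib-* x y t)) ⟨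
    pairTerm r t                                            ∎
    where
    coeff = r C t
    d = r ∸ 2 ℕ.* t
    u = x ^ t
    v = y ^ t
    t≤r : t ≤ r
    t≤r = ≤-trans (m≤m+n t (t ℕ.+ 0)) 2t≤r
    split : ∀ z → z ^ (r ∸ t) ≈ z ^ t * z ^ d
    split z = trans (reflexive (≡.cong (z ^_) (∸-half {r} {t} 2t≤r))) (^-homo-* z t d)
    -- x^t y^(r-t) = x^t (y^t y^d)  and, by C(r,r-t) = C(r,t),  x^(r-t) y^t = (x^t x^d) y^t.
    lower : binomialTerm r t ≈ coeff × (u * (v * y ^ d))
    lower = ×-congʳ coeff (*-congˡ (split y))
    upper : binomialTerm r (r ∸ t) ≈ coeff × ((u * x ^ d) * v)
    upper = ×-cong (≡.sym (nCk≡nC[n∸k] t≤r)) (*-cong (split x) (reflexive (≡.cong (y ^_) (m∸[m∸n]≡n t≤r))))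
    factor : ∀ a b → u * (v * a) + (u * b) * v ≈ (u * v) * (b + a)
    factor a b = begin
      u * (v * a) + (u * b) * v    ≈⟨ +-cong (sym (*-assoc u v a)) swap ⟩
      (u * v) * a + (u * v) * b    ≈⟨ distribˡ (u * v) a b ⟨
      (u * v) * (a + b)            ≈⟨ *-congˡ (+-comm a b) ⟩
      (u * v) * (b + a)            ∎
      where
      swap : (u * b) * v ≈ (u * v) * b
      swap = trans (*-assoc u b v) (trans (*-congˡ (*-comm b v)) (sym (*-assoc u v b)))

  symmetric-binomial : ∀ n k r → suc r ≡ n ℕ.+ k ℕ.+ n →
    (x + y) ^ r ≈ Σ< n (pairTerm r) + Σ< k (λ i → binomialTerm r (n ℕ.+ i))
  symmetric-binomial n k r e = begin
    (x + y) ^ r                                                  ≈⟨ binomial-theorem r ⟩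
    Σ< (suc r) (binomialTerm r)                                  ≡⟨ ≡.cong (λ N → Σ< N (binomialTerm r)) e ⟩
    Σ< (n ℕ.+ k ℕ.+ n) (binomialTerm r)                          ≈⟨ Σ<-pair n k (binomialTerm r) ⟩
    Σ< n (λ t → binomialTerm r t + binomialTerm r (n ℕ.+ k ℕ.+ n ∸ suc t)) + middle
                                                                 ≈⟨ +-congʳ (Σ<-cong n paired) ⟩
    Σ< n (pairTerm r) + middle                                   ∎
    where
    middle = Σ< k (λ i → binomialTerm r (n ℕ.+ i))
    paired : ∀ t → t < n → binomialTerm r t + binomialTerm r (n ℕ.+ k ℕ.+ n ∸ suc t) ≈ pairTerm r t
    paired t t<n = trans (+-congˡ (reflexive (≡.cong (λ N → binomialTerm r (N ∸ suc t)) (≡.sym e))))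
                         (pair-binomialTerms r t (paired-index-bound n k e t<n))

  symmetric-binomial-odd : ∀ n r → suc r ≡ n ℕ.+ n → (x + y) ^ r ≈ Σ< n (pairTerm r)
  symmetric-binomial-odd n r e =
    trans (symmetric-binomial n 0 r (≡.trans e (≡.cong (ℕ._+ n) (≡.sym (ℕₚ.+-identityʳ n))))) (+-identityʳ _)

  symmetric-binomial-even : ∀ n r → r ≡ n ℕ.+ n → (x + y) ^ r ≈ Σ< n (pairTerm r) + (r C n) × (x * y) ^ n
  symmetric-binomial-even n r e =
    trans (symmetric-binomial n 1 r (≡.trans (≡.cong suc e) (≡.sym (≡.trans (ℕₚ.+-assoc n 1 n) (+-suc n n)))))
          (+-congˡ central)
    where
    central : binomialTerm r (n ℕ.+ 0) + 0# ≈ (r C n) × (x * y) ^ n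
    central = begin
      binomialTerm r (n ℕ.+ 0) + 0#     ≈⟨ +-identityʳ _ ⟩
      binomialTerm r (n ℕ.+ 0)          ≡⟨ ≡.cong (binomialTerm r) (ℕₚ.+-identityʳ n) ⟩
      (r C n) × (x ^ n * y ^ (r ∸ n))   ≡⟨ ≡.cong (λ j → (r C n) × (x ^ n * y ^ j)) (≡.trans (≡.cong (_∸ n) e) (m+n∸n≡m n n)) ⟩
      (r C n) × (x ^ n * y ^ n)         ≈⟨ ×-congʳ (r C n) (^-distrib-* x y n) ⟨
      (r C n) × (x * y) ^ n             ∎

open import Defs
open import Data.Nat as ℕ using (ℕ; zero; suc; _∸_; _%_; _/_)
import Data.Nat.Properties as ℕₚ
open import Data.Nat.Combinatorics using (_C_)
open import Data.Nat.DivMod using (+-distrib-/-∣ʳ; m*n/n≡m; [m+kn]%n≡m%n; m≡m%n+[m/n]*n)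
open import Data.Nat.Divisibility using (divides-refl)
open import Data.Nat.Primality using (Prime)
import Data.Nat.Tactic.RingSolver as ℕ-Solver
open import Data.Integer using (ℤ; +_; _+_; _*_; _-_; -_; _^_; 0ℤ)
import Data.Integer.Properties as ℤₚ
open import Data.List using (map; upTo; applyUpTo)
open import Data.Product using (_×_; _,_; proj₁)
open import Data.Empty using (⊥-elim)
open import Function using (_∘_)
open import Relation.Nullary using (Dec; yes; no; ¬_)
open import Relation.Binary.PropositionalEquality
  using (_≡_; refl; cong; cong₂; trans; sym; subst; module ≡-Reasoning)
open ≡-Reasoning

module ℤ[√-3] where

  open import Data.Integer.Tactic.RingSolver using (solve-∀)
  open import Relation.Binary.PropositionalEquality.Algebra using (isMagma)
  open import Algebra.Structures.Biased {A = ℤω} _≡_ using (isCommutativeMonoidˡ; isCommutativeSemiringˡ)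

  ι : ℤ → ℤω
  ι c = c , 0ℤ

  ⊕-assoc : ∀ u v w → (u ⊕ v) ⊕ w ≡ u ⊕ (v ⊕ w)
  ⊕-assoc (a , b) (c , d) (e , f) = cong₂ _,_ (ℤₚ.+-assoc a c e) (ℤₚ.+-assoc b d f)

  ⊕-comm : ∀ u v → u ⊕ v ≡ v ⊕ u
  ⊕-comm (a , b) (c , d) = cong₂ _,_ (ℤₚ.+-comm a c) (ℤₚ.+-comm b d)

  ⊕-identityˡ : ∀ u → ι 0ℤ ⊕ u ≡ u
  ⊕-identityˡ (a , b) = cong₂ _,_ (ℤₚ.+-identityˡ a) (ℤₚ.+-identityˡ b)

  ⊗-assoc : ∀ u v w → (u ⊗ v) ⊗ w ≡ u ⊗ (v ⊗ w)
  ⊗-assoc (a , b) (c , d) (e , f) = cong₂ _,_ (re a b c d e f) (im a b c d e f)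
    where
    re : ∀ a b c d e f → (a * c - + 3 * (b * d)) * e - + 3 * ((a * d + c * b) * f)
                         ≡ a * (c * e - + 3 * (d * f)) - + 3 * (b * (c * f + e * d))
    re = solve-∀
    im : ∀ a b c d e f → (a * c - + 3 * (b * d)) * f + e * (a * d + c * b)
                         ≡ a * (c * f + e * d) + (c * e - + 3 * (d * f)) * b
    im = solve-∀

  ⊗-comm : ∀ u v → u ⊗ v ≡ v ⊗ u
  ⊗-comm (a , b) (c , d) = cong₂ _,_ (re a b c d) (ℤₚ.+-comm (a * d) (c * b))
    where
    re : ∀ a b c d → a * c - + 3 * (b * d) ≡ c * a - + 3 * (d * b)
    re = solve-∀

  ⊗-identityˡ : ∀ u → ι (+ 1) ⊗ u ≡ u
  ⊗-identityˡ (a , b) = cong₂ _,_ (re a b) (im a b)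
    where
    re : ∀ a b → + 1 * a - + 3 * (0ℤ * b) ≡ a
    re = solve-∀
    im : ∀ a b → + 1 * b + a * 0ℤ ≡ b
    im = solve-∀

  ⊗-zeroˡ : ∀ u → ι 0ℤ ⊗ u ≡ ι 0ℤ
  ⊗-zeroˡ (a , b) = cong₂ _,_ refl (trans (ℤₚ.+-identityˡ (a * 0ℤ)) (ℤₚ.*-zeroʳ a))

  ⊗-distribʳ : ∀ w u v → (u ⊕ v) ⊗ w ≡ (u ⊗ w) ⊕ (v ⊗ w)
  ⊗-distribʳ (a , b) (c , d) (e , f) = cong₂ _,_ (re a b c d e f) (im a b c d e f)
    where
    re : ∀ a b c d e f → (c + e) * a - + 3 * ((d + f) * b) ≡ (c * a - + 3 * (d * b)) + (e * a - + 3 * (f * b))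
    re = solve-∀
    im : ∀ a b c d e f → (c + e) * b + a * (d + f) ≡ (c * b + a * d) + (e * b + a * f)
    im = solve-∀

  ℤω-commutativeSemiring : CommutativeSemiring _ _
  ℤω-commutativeSemiring = record
    { _+_ = _⊕_
    ; _*_ = _⊗_
    ; 0# = ι 0ℤ
    ; 1# = ι (+ 1)
    ; isCommutativeSemiring = isCommutativeSemiringˡ record
      { +-isCommutativeMonoid = isCommutativeMonoidˡ record
        { isSemigroup = record { isMagma = isMagma _⊕_ ; assoc = ⊕-assoc }
        ; identityˡ = ⊕-identityˡ
        ; comm = ⊕-comm
        }
      ; *-isCommutativeMonoid = isCommutativeMonoidˡ record
        { isSemigroup = record { isMagma = isMagma _⊗_ ; assoc = ⊗-assoc }
        ; identityˡ = ⊗-identityˡ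
        ; comm = ⊗-comm
        }
      ; distribʳ = ⊗-distribʳ
      ; zeroˡ = ⊗-zeroˡ
      }
    }

  open CommutativeSemiring ℤω-commutativeSemiring using (semiring; +-rawMonoid; +-commutativeMonoid)
  open import Algebra.Properties.Semiring.Exp semiring public using () renaming (_^_ to _^ω_)
  open import Algebra.Definitions.RawMonoid +-rawMonoid public using () renaming (_×_ to _·ω_)
  module Σℤ = InitialSums ℤₚ.+-0-commutativeMonoid
  module Σω = InitialSums +-commutativeMonoid

  pow≡^ω : ∀ z n → pow z n ≡ z ^ω n
  pow≡^ω z zero    = refl
  pow≡^ω z (suc n) = cong (z ⊗_) (pow≡^ω z n)

  ι-⊗ : ∀ c d → ι c ⊗ ι d ≡ ι (c * d)
  ι-⊗ c d = cong₂ _,_ (re c d) (im c d)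
    where
    re : ∀ c d → c * d - + 3 * (0ℤ * 0ℤ) ≡ c * d
    re = solve-∀
    im : ∀ c d → c * 0ℤ + d * 0ℤ ≡ 0ℤ
    im = solve-∀

  ι-^ : ∀ c n → ι c ^ω n ≡ ι (c ^ n)
  ι-^ c zero    = refl
  ι-^ c (suc n) = trans (cong (ι c ⊗_) (ι-^ c n)) (ι-⊗ c (c ^ n))

  ι-× : ∀ n c → n ·ω ι c ≡ ι (+ n * c)
  ι-× zero    c = refl
  ι-× (suc n) c = trans (cong (ι c ⊕_) (ι-× n c)) (cong ι (sym (ℤₚ.suc-* (+ n) c)))

  ι-Σ< : ∀ n g → Σω.Σ< n (ι ∘ g) ≡ ι (Σℤ.Σ< n g)
  ι-Σ< zero    g = refl
  ι-Σ< (suc n) g = cong (ι (g 0) ⊕_) (ι-Σ< n (g ∘ suc))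

  conj-⊗ : ∀ u v → conj (u ⊗ v) ≡ conj u ⊗ conj v
  conj-⊗ (a , b) (c , d) = cong₂ _,_ (re a b c d) (im a b c d)
    where
    re : ∀ a b c d → a * c - + 3 * (b * d) ≡ a * c - + 3 * ((- b) * (- d))
    re = solve-∀
    im : ∀ a b c d → - (a * d + c * b) ≡ a * (- d) + c * (- b)
    im = solve-∀

  conj-^ω : ∀ z n → conj z ^ω n ≡ conj (z ^ω n)
  conj-^ω z zero    = refl
  conj-^ω z (suc n) = trans (cong (conj z ⊗_) (conj-^ω z n)) (sym (conj-⊗ z (z ^ω n)))

  trace-rational : ∀ z → z ⊕ conj z ≡ ι (proj₁ (z ⊕ conj z))
  trace-rational (a , b) = cong₂ _,_ refl (ℤₚ.+-inverseʳ b)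

  trace : ℤω → ℕ → ℤ
  trace z j = proj₁ ((z ^ω j) ⊕ (conj z ^ω j))

  z^j+z̄^j : ∀ z j → (z ^ω j) ⊕ (conj z ^ω j) ≡ ι (trace z j)
  z^j+z̄^j z j = trans (cong ((z ^ω j) ⊕_) (conj-^ω z j))
    (trans (trace-rational (z ^ω j)) (cong (λ w → ι (proj₁ ((z ^ω j) ⊕ w))) (sym (conj-^ω z j))))

  norm : ∀ {n} a b → + n ≡ a * a + + 3 * (b * b) → (a , b) ⊗ conj (a , b) ≡ ι (+ n)
  norm a b n≡ = cong₂ _,_ (trans (re a b) (sym n≡)) (im a b)
    where
    re : ∀ a b → a * a - + 3 * (b * (- b)) ≡ a * a + + 3 * (b * b)
    re = solve-∀
    im : ∀ a b → a * (- b) + a * b ≡ 0ℤ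
    im = solve-∀

module PowersOfTrace (p : ℕ) (a b : ℤ) (normα : + p ≡ a * a + + 3 * (b * b)) (m : ℕ) where

  open ℤ[√-3]

  α : ℤω
  α = a , b

  x y : ℤω
  x = α ^ω m
  y = conj α ^ω m

  open SymmetricBinomial ℤω-commutativeSemiring x y
  open CommutativeSemiring ℤω-commutativeSemiring using (semiring)
  open import Algebra.Properties.Semiring.Exp semiring using (^-assocʳ)
  open import Algebra.Properties.CommutativeSemiring.Exp ℤω-commutativeSemiring using (^-distrib-*)

  power-of-power : ∀ z d → (z ^ω m) ^ω d ≡ z ^ω (d ℕ.* m)
  power-of-power z d = trans (^-assocʳ z m d) (cong (z ^ω_) (ℕₚ.*-comm m d))

  x^d+y^d : ∀ d → (x ^ω d) ⊕ (y ^ω d) ≡ ι (trace α (d ℕ.* m))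
  x^d+y^d d = trans (cong₂ _⊕_ (power-of-power α d) (power-of-power (conj α) d)) (z^j+z̄^j α (d ℕ.* m))

  [xy]^t : ∀ t → (x ⊗ y) ^ω t ≡ ι ((+ p) ^ (t ℕ.* m))
  [xy]^t t = begin
    (x ⊗ y) ^ω t                    ≡⟨ cong (_^ω t) (^-distrib-* α (conj α) m) ⟨
    ((α ⊗ conj α) ^ω m) ^ω t        ≡⟨ power-of-power (α ⊗ conj α) t ⟩
    (α ⊗ conj α) ^ω (t ℕ.* m)       ≡⟨ cong (_^ω (t ℕ.* m)) (norm a b normα) ⟩
    ι (+ p) ^ω (t ℕ.* m)            ≡⟨ ι-^ (+ p) (t ℕ.* m) ⟩
    ι ((+ p) ^ (t ℕ.* m))           ∎

  term : ℕ → ℕ → ℤ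
  term r t = + (r C t) * (+ p) ^ (t ℕ.* m) * trace α ((r ∸ 2 ℕ.* t) ℕ.* m)

  central : ℕ → ℕ → ℤ
  central r n = + (r C n) * (+ p) ^ (n ℕ.* m)

  pairTerm≡term : ∀ r t → pairTerm r t ≡ ι (term r t)
  pairTerm≡term r t = begin
    (r C t) ·ω (((x ⊗ y) ^ω t) ⊗ ((x ^ω d) ⊕ (y ^ω d)))  ≡⟨ cong ((r C t) ·ω_) (cong₂ _⊗_ ([xy]^t t) (x^d+y^d d)) ⟩
    (r C t) ·ω (ι P ⊗ ι T)                               ≡⟨ cong ((r C t) ·ω_) (ι-⊗ P T) ⟩
    (r C t) ·ω ι (P * T)                                 ≡⟨ ι-× (r C t) (P * T) ⟩
    ι (+ (r C t) * (P * T))                              ≡⟨ cong ι (ℤₚ.*-assoc (+ (r C t)) P T) ⟨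
    ι (term r t)                                         ∎
    where
    d = r ∸ 2 ℕ.* t
    P = (+ p) ^ (t ℕ.* m)
    T = trace α (d ℕ.* m)

  centralTerm≡central : ∀ r n → (r C n) ·ω (x ⊗ y) ^ω n ≡ ι (central r n)
  centralTerm≡central r n = trans (cong ((r C n) ·ω_) ([xy]^t n)) (ι-× (r C n) _)

  ι-trace-power : ∀ r → ι (trace α m ^ r) ≡ (x ⊕ y) ^ω r
  ι-trace-power r = trans (sym (ι-^ (trace α m) r)) (cong (_^ω r) (sym (z^j+z̄^j α m)))

  trace-power-odd : ∀ n r → suc r ≡ n ℕ.+ n → trace α m ^ r ≡ Σℤ.Σ< n (term r)
  trace-power-odd n r e = cong proj₁ (begin
    ι (trace α m ^ r)       ≡⟨ ι-trace-power r ⟩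
    (x ⊕ y) ^ω r            ≡⟨ symmetric-binomial-odd n r e ⟩
    Σω.Σ< n (pairTerm r)    ≡⟨ Σω.Σ<-cong n (λ t _ → pairTerm≡term r t) ⟩
    Σω.Σ< n (ι ∘ term r)    ≡⟨ ι-Σ< n (term r) ⟩
    ι (Σℤ.Σ< n (term r))    ∎)

  trace-power-even : ∀ n r → r ≡ n ℕ.+ n → trace α m ^ r ≡ Σℤ.Σ< n (term r) + central r n
  trace-power-even n r e = cong proj₁ (begin
    ι (trace α m ^ r)                                 ≡⟨ ι-trace-power r ⟩
    (x ⊕ y) ^ω r                                      ≡⟨ symmetric-binomial-even n r e ⟩
    Σω.Σ< n (pairTerm r) ⊕ ((r C n) ·ω (x ⊗ y) ^ω n)  ≡⟨ cong₂ _⊕_ (Σω.Σ<-cong n (λ t _ → pairTerm≡term r t)) (centralTerm≡central r n) ⟩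
    Σω.Σ< n (ι ∘ term r) ⊕ ι (central r n)            ≡⟨ cong (_⊕ ι (central r n)) (ι-Σ< n (term r)) ⟩
    ι (Σℤ.Σ< n (term r) + central r n)                ∎)

open ℤ[√-3] using (trace; pow≡^ω; module Σℤ)

half : ∀ j h → (j ℕ.+ h ℕ.* 2) / 2 ≡ j / 2 ℕ.+ h
half j h = trans (+-distrib-/-∣ʳ j (divides-refl h)) (cong (j / 2 ℕ.+_) (m*n/n≡m h 2))

parity : ∀ j h → (j ℕ.+ h ℕ.* 2) % 2 ≡ j % 2
parity j h = [m+kn]%n≡m%n j h 2

data OddOrEven : ℕ → Set where
  odd  : ∀ h → OddOrEven (1 ℕ.+ h ℕ.* 2)
  even : ∀ h → OddOrEven (2 ℕ.+ h ℕ.* 2)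

oddOrEven : ∀ r → OddOrEven (suc r)
oddOrEven zero = odd 0
oddOrEven (suc r) with oddOrEven r
... | odd h  = even h
... | even h = odd (suc h)

gammaP-split : ∀ n p {a b} → p % 6 ≡ 1 → gammaP n p a b ≡ trace (a , b) (n ∸ 1)
gammaP-split n p {a} {b} p≡1 with p % 6 ℕ.≟ 1
... | yes _   = cong₂ (λ u v → proj₁ (u ⊕ v)) (pow≡^ω (a , b) (n ∸ 1)) (pow≡^ω (conj (a , b)) (n ∸ 1))
... | no p≢1  = ⊥-elim (p≢1 p≡1)

gammaP-inert : ∀ n p {a b} → ¬ p % 6 ≡ 1 → gammaP n p a b ≡ 0ℤ
gammaP-inert n p p≢1 with p % 6 ℕ.≟ 1
... | yes p≡1 = ⊥-elim (p≢1 p≡1)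
... | no _    = refl

selector-even : ∀ p r {v} → p % 6 ≡ 1 → r % 2 ≡ 0 → if1mod6∧even p r v ≡ v
selector-even p r p≡1 r-even with p % 6 ℕ.≟ 1 | r % 2 ℕ.≟ 0
... | yes _   | yes _    = refl
... | no p≢1  | _        = ⊥-elim (p≢1 p≡1)
... | yes _   | no r-odd = ⊥-elim (r-odd r-even)

selector-odd : ∀ p r {v} → r % 2 ≡ 1 → if1mod6∧even p r v ≡ 0ℤ
selector-odd p r r-odd with p % 6 ℕ.≟ 1 | r % 2 ℕ.≟ 0
... | yes _ | yes r-even = ⊥-elim (1≢0 (trans (sym r-odd) r-even))
  where 1≢0 : ¬ 1 ≡ 0
        1≢0 ()
... | yes _ | no _ = refl
... | no _  | _    = refl

selector-inert : ∀ p r {v} → ¬ p % 6 ≡ 1 → if1mod6∧even p r v ≡ 0ℤ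
selector-inert p r p≢1 with p % 6 ℕ.≟ 1 | r % 2 ℕ.≟ 0
... | yes p≡1 | _ = ⊥-elim (p≢1 p≡1)
... | no _    | yes _ = refl
... | no _    | no _  = refl

gamma3-odd : ∀ c → gamma3 (1 ℕ.+ c ℕ.* 2) ≡ (- + 3) ^ c
gamma3-odd c with (1 ℕ.+ c ℕ.* 2) % 2 ℕ.≟ 1
... | yes _  = cong ((- + 3) ^_) (m*n/n≡m c 2)
... | no ≢1  = ⊥-elim (≢1 (parity 1 c))

sumℤ-upTo : ∀ n G → sumℤ (map G (upTo n)) ≡ Σℤ.Σ< n G
sumℤ-upTo = sumℤ-applyUpTo (λ i → i)
  where
  sumℤ-applyUpTo : ∀ f n G → sumℤ (map G (applyUpTo f n)) ≡ Σℤ.Σ< n (G ∘ f)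
  sumℤ-applyUpTo f zero    G = refl
  sumℤ-applyUpTo f (suc n) G = cong (λ s → G (f 0) + s) (sumℤ-applyUpTo (f ∘ suc) n G)

expansionTerm : ℕ → ℕ → ℤ → ℤ → ℕ → ℕ → ℤ
expansionTerm k p a b r t = + (r C t) * ((+ p) ^ (t ℕ.* (k ∸ 1))) * gammaP ((r ∸ 2 ℕ.* t) ℕ.* (k ∸ 1) ℕ.+ 1) p a b

foldedSum : ℕ → ℕ → ℤ → ℤ → ℕ → ℤ
foldedSum k p a b r = sumℤ (map (expansionTerm k p a b r) (upTo (suc ((r ∸ 1) / 2))))

foldedCentral : ℕ → ℕ → ℕ → ℤ
foldedCentral k p r = if1mod6∧even p r (+ (r C (r / 2)) * ((+ p) ^ ((r / 2) ℕ.* (k ∸ 1))))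

module Split (k p : ℕ) (a b : ℤ) (p≡1 : p % 6 ≡ 1) (normα : + p ≡ a * a + + 3 * (b * b)) where

  m : ℕ
  m = k ∸ 1

  open PowersOfTrace p a b normα m using (trace-power-odd; trace-power-even; term; central)

  expansionTerm≡term : ∀ r t → expansionTerm k p a b r t ≡ term r t
  expansionTerm≡term r t =
    cong (+ (r C t) * (+ p) ^ (t ℕ.* m) *_) (trans (gammaP-split (d ℕ.+ 1) p p≡1) (cong (trace (a , b)) (ℕₚ.m+n∸n≡m d 1)))
    where d = (r ∸ 2 ℕ.* t) ℕ.* m

  foldedSum≡ : ∀ {r h} → (r ∸ 1) / 2 ≡ h → foldedSum k p a b r ≡ Σℤ.Σ< (suc h) (term r)
  foldedSum≡ {r} {h} half≡h = begin
    foldedSum k p a b r                                 ≡⟨ sumℤ-upTo (suc ((r ∸ 1) / 2)) (expansionTerm k p a b r) ⟩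
    Σℤ.Σ< (suc ((r ∸ 1) / 2)) (expansionTerm k p a b r) ≡⟨ Σℤ.Σ<-cong (suc ((r ∸ 1) / 2)) (λ t _ → expansionTerm≡term r t) ⟩
    Σℤ.Σ< (suc ((r ∸ 1) / 2)) (term r)                  ≡⟨ cong (λ n → Σℤ.Σ< (suc n) (term r)) half≡h ⟩
    Σℤ.Σ< (suc h) (term r)                              ∎

  odd-halves : ∀ h → suc (1 ℕ.+ h ℕ.* 2) ≡ suc h ℕ.+ suc h
  odd-halves = ℕ-Solver.solve-∀

  even-halves : ∀ h → 2 ℕ.+ h ℕ.* 2 ≡ suc h ℕ.+ suc h
  even-halves = ℕ-Solver.solve-∀

  power : ∀ r → OddOrEven r → gammaP k p a b ^ r ≡ foldedSum k p a b r + foldedCentral k p r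
  power r (odd h) = begin
    gammaP k p a b ^ r                         ≡⟨ cong (_^ r) (gammaP-split k p p≡1) ⟩
    trace (a , b) m ^ r                        ≡⟨ trace-power-odd (suc h) r (odd-halves h) ⟩
    Σℤ.Σ< (suc h) (term r)                     ≡⟨ foldedSum≡ (half 0 h) ⟨
    foldedSum k p a b r                        ≡⟨ ℤₚ.+-identityʳ _ ⟨
    foldedSum k p a b r + 0ℤ                   ≡⟨ cong (λ c → foldedSum k p a b r + c) (selector-odd p r (parity 1 h)) ⟨
    foldedSum k p a b r + foldedCentral k p r  ∎
  power r (even h) = begin
    gammaP k p a b ^ r                         ≡⟨ cong (_^ r) (gammaP-split k p p≡1) ⟩
    trace (a , b) m ^ r                        ≡⟨ trace-power-even (suc h) r (even-halves h) ⟩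
    Σℤ.Σ< (suc h) (term r) + central r (suc h) ≡⟨ cong₂ _+_ (foldedSum≡ (half 1 h)) central≡ ⟨
    foldedSum k p a b r + foldedCentral k p r  ∎
    where
    central≡ : foldedCentral k p r ≡ central r (suc h)
    central≡ = trans (selector-even p r p≡1 (parity 2 h)) (cong (central r) (half 2 h))

-- p ≢ 1 (mod 6): both sides vanish (the left one because r ≥ 1).
inert-power : ∀ k p a b → ¬ p % 6 ≡ 1 → ∀ r → gammaP k p a b ^ suc r ≡ foldedSum k p a b (suc r) + foldedCentral k p (suc r)
inert-power k p a b p≢1 r = begin
  gammaP k p a b ^ suc r                                 ≡⟨ cong (_^ suc r) (gammaP-inert k p p≢1) ⟩
  0ℤ                                                     ≡⟨ cong₂ _+_ foldedSum≡0 (selector-inert p (suc r) p≢1) ⟨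
  foldedSum k p a b (suc r) + foldedCentral k p (suc r)  ∎
  where
  foldedSum≡0 : foldedSum k p a b (suc r) ≡ 0ℤ
  foldedSum≡0 = trans (sumℤ-upTo n (expansionTerm k p a b (suc r)))
                      (trans (Σℤ.Σ<-cong n (λ t _ → vanishes t)) (Σℤ.Σ<-zero n))
    where
    n = suc ((suc r ∸ 1) / 2)
    vanishes : ∀ t → expansionTerm k p a b (suc r) t ≡ 0ℤ
    vanishes t = trans (cong (coeff *_) (gammaP-inert _ p p≢1)) (ℤₚ.*-zeroʳ coeff)
      where coeff = + (suc r C t) * (+ p) ^ (t ℕ.* (k ∸ 1))

-- γ_k(3)^r = γ_{r(k-1)+1}(3) for odd k = 1 + 2c: both sides are (-3)^{rc}.
gamma3-power : ∀ k → k % 2 ≡ 1 → ∀ r → gamma3 k ^ r ≡ gamma3 (r ℕ.* (k ∸ 1) ℕ.+ 1)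
gamma3-power k k-odd r = subst (λ k → gamma3 k ^ r ≡ gamma3 (r ℕ.* (k ∸ 1) ℕ.+ 1)) (sym k≡) (odd-power (k / 2))
  where
  k≡ : k ≡ 1 ℕ.+ k / 2 ℕ.* 2
  k≡ = trans (m≡m%n+[m/n]*n k 2) (cong (ℕ._+ k / 2 ℕ.* 2) k-odd)
  reindex : ∀ r c → 1 ℕ.+ r ℕ.* c ℕ.* 2 ≡ r ℕ.* (c ℕ.* 2) ℕ.+ 1
  reindex = ℕ-Solver.solve-∀
  odd-power : ∀ c → gamma3 (1 ℕ.+ c ℕ.* 2) ^ r ≡ gamma3 (r ℕ.* (c ℕ.* 2) ℕ.+ 1)
  odd-power c = begin
    gamma3 (1 ℕ.+ c ℕ.* 2) ^ r       ≡⟨ cong (_^ r) (gamma3-odd c) ⟩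
    ((- + 3) ^ c) ^ r                ≡⟨ ℤₚ.^-*-assoc (- + 3) c r ⟩
    (- + 3) ^ (c ℕ.* r)              ≡⟨ cong ((- + 3) ^_) (ℕₚ.*-comm c r) ⟩
    (- + 3) ^ (r ℕ.* c)              ≡⟨ gamma3-odd (r ℕ.* c) ⟨
    gamma3 (1 ℕ.+ r ℕ.* c ℕ.* 2)     ≡⟨ cong gamma3 (reindex r c) ⟩
    gamma3 (r ℕ.* (c ℕ.* 2) ℕ.+ 1)   ∎

-- The identities hold without using that p is a prime > 3 or that k ≥ 2.
corollary1p2 : (k : ℕ) → 2 ℕ.≤ k →
    ((p : ℕ) → Prime p → 3 ℕ.< p → (r : ℕ) → 1 ℕ.≤ r → (a b : ℤ) → (p % 6 ≡ 1 → IsRep p a b) →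
      gammaP k p a b ^ r
        ≡ sumℤ (map (λ t → + (r C t) * ((+ p) ^ (t ℕ.* (k ∸ 1))) * gammaP ((r ∸ 2 ℕ.* t) ℕ.* (k ∸ 1) ℕ.+ 1) p a b)
                    (upTo (ℕ.suc ((r ∸ 1) / 2))))
          + (if1mod6∧even p r (+ (r C (r / 2)) * ((+ p) ^ ((r / 2) ℕ.* (k ∸ 1))))))
    × (k % 2 ≡ 1 → (r : ℕ) → 1 ℕ.≤ r → gamma3 k ^ r ≡ gamma3 (r ℕ.* (k ∸ 1) ℕ.+ 1))
corollary1p2 k _ = powers-at-p , (λ k-odd r _ → gamma3-power k k-odd r)
  where
  powers-at-p : (p : ℕ) → Prime p → 3 ℕ.< p → (r : ℕ) → 1 ℕ.≤ r → (a b : ℤ) → (p % 6 ≡ 1 → IsRep p a b) →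
                gammaP k p a b ^ r ≡ foldedSum k p a b r + foldedCentral k p r
  powers-at-p p _ _ (suc r) _ a b rep = by-cases (p % 6 ℕ.≟ 1)
    where
    by-cases : Dec (p % 6 ≡ 1) → gammaP k p a b ^ suc r ≡ foldedSum k p a b (suc r) + foldedCentral k p (suc r)
    by-cases (yes p≡1) = Split.power k p a b p≡1 (proj₁ (rep p≡1)) (suc r) (oddOrEven r)
    by-cases (no p≢1)  = inert-power k p a b p≢1 r
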